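{- Consider the Disjoint Domination Game in which Dom is allowed to pass but Sepy is not. Then (i) for every finite simple graph $G$ without isolated vertices, Dom has a winning strategy in the Sepy-start game on $G$; and (ii) Dom has a winning strategy in the Dom-start game on every finite simple isolate-free graph $G$ that has at least one Dom-win component.
   Context: For a vertex $v$, $N[v]$ denotes its closed neighborhood. The Disjoint Domination Game (DDG) on an isolate-free graph $G=(V,E)$: Dom and Sepy alternately choose a previously uncolored vertex $v$ and color it purple or blue (either player may use either color). With $V_p,V_b$ the current color classes, coloring $v$ with $c$ is legal iff $v\notin V_p\cup V_b$ and some $u\in N[v]$ has $N[u]\cap V_c=\emptyset$. A player who is not allowed to pass must make a legal move on his turn; a player allowed to pass may skip any of his turns except that the very first move of the game may not be a pass. The game terminates as soon as either (s) some vertex has its whole closed neighborhood colored with a single color (Sepy wins), or (d) both $V_p$ and $V_b$ are dominating sets of $G$ (Dom wins). In the Dom-start (resp. Sepy-start) game Dom (resp. Sepy) moves first. A Dom-win component of $G$ is a connected component $H$ of $G$ such that Dom has a winning strategy in the Dom-start DDG (without passing) played on $H$ alone. -}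

module Defs where

open import Data.Nat using (ℕ; _≤_)
open import Data.Fin using (Fin; _≟_)
open import Data.Bool using (Bool; true; false; if_then_else_)
open import Data.Maybe using (Maybe; just; nothing)
open import Data.Product using (Σ; ∃; ∃-syntax; _×_; _,_)
open import Data.Sum using (_⊎_)
open import Relation.Nullary using (¬_)
open import Relation.Nullary.Decidable using (⌊_⌋)
open import Relation.Binary.PropositionalEquality using (_≡_; _≢_)
open import Function.Definitions using (Injective)

record Graph (n : ℕ) : Set where
  field
    adj   : Fin n → Fin n → Bool
    sym   : ∀ u v → adj u v ≡ adj v u
    irrefl : ∀ v → adj v v ≡ false
open Graph public

module _ {n : ℕ} (G : Graph n) where

  InN : Fin n → Fin n → Set
  InN v w = (w ≡ v) ⊎ (adj G v w ≡ true)

  IsolateFree : Set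
  IsolateFree = ∀ v → ∃[ u ] adj G v u ≡ true

data Color : Set where
  purple blue : Color

-- a partial coloring: nothing = uncolored
Coloring : ℕ → Set
Coloring n = Fin n → Maybe Color

empty : ∀ {n} → Coloring n
empty _ = nothing

update : ∀ {n} → Coloring n → Fin n → Color → Coloring n
update s v c w = if ⌊ w ≟ v ⌋ then just c else s w

module _ {n : ℕ} (G : Graph n) where

  Dominating : Coloring n → Color → Set
  Dominating s c = ∀ u → ∃[ w ] (InN G u w × s w ≡ just c)

  SepyWon : Coloring n → Set
  SepyWon s = ∃[ v ] ∃[ c ] (∀ w → InN G v w → s w ≡ just c)

  DomWon : Coloring n → Set
  DomWon s = Dominating s purple × Dominating s blue

  Terminal : Coloring n → Set
  Terminal s = SepyWon s ⊎ DomWon s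

  Legal : Coloring n → Fin n → Color → Set
  Legal s v c = (s v ≡ nothing) ×
                (∃[ u ] (InN G v u × (∀ w → InN G u w → s w ≢ just c)))

data Player : Set where
  dom sepy : Player

-- DomWins G pass p first s : Dom has a winning strategy from position s with
-- player p to move; 'pass' says whether Dom is allowed to pass (Sepy never is);
-- 'first' says whether the next move is the very first move of the game
-- (which may not be a pass).
data DomWins {n : ℕ} (G : Graph n) (pass : Bool) : Player → Bool → Coloring n → Set where
  won   : ∀ {p f s} → DomWon G s → ¬ SepyWon G s → DomWins G pass p f s
  dmove : ∀ {f s} v c → ¬ Terminal G s → Legal G s v c →
          DomWins G pass sepy false (update s v c) → DomWins G pass dom f s
  dpass : ∀ {s} → ¬ Terminal G s → pass ≡ true →
          DomWins G pass sepy false s → DomWins G pass dom false s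
  smove : ∀ {f s} → ¬ Terminal G s →
          (∀ v c → Legal G s v c → DomWins G pass dom false (update s v c)) →
          DomWins G pass sepy f s

data Reach {m : ℕ} (H : Graph m) : Fin m → Fin m → Set where
  here : ∀ {i} → Reach H i i
  step : ∀ {i j k} → adj H i j ≡ true → Reach H j k → Reach H i k

Connected : ∀ {m} → Graph m → Set
Connected H = ∀ i j → Reach H i j

-- H (on Fin m) embedded via f is (isomorphic to) a connected component of G
record IsComponent {n m : ℕ} (G : Graph n) (H : Graph m) (f : Fin m → Fin n) : Set where
  field
    nonempty  : 1 ≤ m
    injective : Injective _≡_ _≡_ f
    induced   : ∀ i j → adj H i j ≡ adj G (f i) (f j)
    connected : Connected H
    closed    : ∀ i v → adj G (f i) v ≡ true → ∃[ j ] f j ≡ v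

-- G has a Dom-win component: Dom wins the Dom-start game on it without passing
HasDomWinComponent : ∀ {n} → Graph n → Set
HasDomWinComponent {n} G =
  ∃[ m ] Σ (Graph m) λ H → Σ (Fin m → Fin n) λ f →
    IsComponent G H f × DomWins H false dom true empty

-- Dom keeps every colored vertex balanced: its closed neighborhood also shows the opposite
-- color, so no closed neighborhood can become monochromatic. When Sepy colors v with c, Dom
-- passes if N[v] already shows the other color, and otherwise gives that color to an uncolored
-- neighbor of v; one exists, since a fully c-colored N[v] would have made Sepy's move illegal
-- in a graph without isolated vertices. Every round colors a vertex, so the game ends, and it
-- cannot end with Sepy's win. In the Dom-start game Dom follows his winning strategy on the
-- Dom-win component H, answering Sepy's moves inside H by that strategy and moves outside H by
-- the rule above; once H is won all of its vertices are balanced too, and Dom passes into the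
-- Sepy-start strategy.
module Submission where

open import Defs hiding (sym)
open import Data.Nat using (ℕ; zero; suc; _+_; _<_)
open import Data.Nat.Properties using (≤-reflexive; +-suc; <-trans)
open import Data.Nat.Induction using (<-wellFounded)
open import Induction.WellFounded using (Acc; acc)
open import Data.Fin using (Fin; zero; suc; _≟_; fromℕ<)
open import Data.Fin.Properties using (any?; all?; suc-injective)
import Data.Bool as Bool
open import Data.Bool using (true; false)
open import Data.Maybe using (Maybe; just; nothing)
open import Data.Maybe.Properties using (just-injective; ≡-dec)
open import Data.Product using (∃-syntax; _×_; _,_; proj₁)
open import Data.Sum using (_⊎_; inj₁; inj₂; [_,_])
open import Data.Empty using (⊥; ⊥-elim)
open import Data.Unit using (tt)
open import Function using (_∘_)
open import Relation.Nullary using (¬_; Dec; yes; no)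
open import Relation.Nullary.Decidable using (_×-dec_; _⊎-dec_; ¬?; decidable-stable)
open import Relation.Unary using (Pred; Decidable; U)
open import Relation.Unary.Properties using (U?)
open import Relation.Binary.PropositionalEquality hiding ([_])

opposite : Color → Color
opposite purple = blue
opposite blue = purple

opposite-involutive : ∀ c → opposite (opposite c) ≡ c
opposite-involutive purple = refl
opposite-involutive blue = refl

opposite-≢ : ∀ c → opposite c ≢ c
opposite-≢ purple ()
opposite-≢ blue ()

_≟ᶜ_ : (c d : Color) → Dec (c ≡ d)
purple ≟ᶜ purple = yes refl
purple ≟ᶜ blue = no λ ()
blue ≟ᶜ purple = no λ ()
blue ≟ᶜ blue = yes refl

_≟ᵐ_ : (x y : Maybe Color) → Dec (x ≡ y)
_≟ᵐ_ = ≡-dec _≟ᶜ_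

remaining-color : ∀ c {m : Maybe Color} → m ≢ nothing → m ≢ just (opposite c) → m ≡ just c
remaining-color c {nothing} uncolored _ = ⊥-elim (uncolored refl)
remaining-color purple {just purple} _ _ = refl
remaining-color purple {just blue} _ notOpposite = ⊥-elim (notOpposite refl)
remaining-color blue {just purple} _ notOpposite = ⊥-elim (notOpposite refl)
remaining-color blue {just blue} _ _ = refl

module _ {n : ℕ} where

  update-same : ∀ (s : Coloring n) v c → update s v c v ≡ just c
  update-same s v c with v ≟ v
  ... | yes _ = refl
  ... | no v≢v = ⊥-elim (v≢v refl)

  update-other : ∀ (s : Coloring n) v c {w} → w ≢ v → update s v c w ≡ s w
  update-other s v c {w} w≢v with w ≟ v
  ... | yes w≡v = ⊥-elim (w≢v w≡v)
  ... | no _ = refl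

  update-cases : ∀ (s : Coloring n) v c w {d} → update s v c w ≡ just d →
                 (w ≡ v × c ≡ d) ⊎ (w ≢ v × s w ≡ just d)
  update-cases s v c w e with w ≟ v
  ... | yes w≡v = inj₁ (w≡v , just-injective e)
  ... | no w≢v = inj₂ (w≢v , e)

  update-colored : ∀ (s : Coloring n) {v} c {w d} → s v ≡ nothing → s w ≡ just d →
                   update s v c w ≡ just d
  update-colored s c {w} sv sw = trans (update-other s _ c w≢v) sw
    where
    w≢v : w ≢ _
    w≢v refl with trans (sym sv) sw
    ... | ()

isUncolored : Maybe Color → ℕ
isUncolored nothing = 1
isUncolored (just _) = 0

#uncolored : ∀ {n} → Coloring n → ℕ
#uncolored {zero} s = 0
#uncolored {suc n} s = isUncolored (s zero) + #uncolored (s ∘ suc)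

#uncolored-cong : ∀ {n} {s t : Coloring n} → s ≗ t → #uncolored s ≡ #uncolored t
#uncolored-cong {zero} s≗t = refl
#uncolored-cong {suc n} s≗t =
  cong₂ _+_ (cong isUncolored (s≗t zero)) (#uncolored-cong (s≗t ∘ suc))

update-suc : ∀ {n} (s : Coloring (suc n)) v c → update s (suc v) c ∘ suc ≗ update (s ∘ suc) v c
update-suc s v c i = by-cases (i ≟ v)
  where
  by-cases : Dec (i ≡ v) → update s (suc v) c (suc i) ≡ update (s ∘ suc) v c i
  by-cases (yes refl) = trans (update-same s (suc v) c) (sym (update-same (s ∘ suc) v c))
  by-cases (no i≢v) = trans (update-other s (suc v) c (i≢v ∘ suc-injective))
                            (sym (update-other (s ∘ suc) v c i≢v))

#uncolored-update : ∀ {n} (s : Coloring n) v c → s v ≡ nothing →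
                    suc (#uncolored (update s v c)) ≡ #uncolored s
#uncolored-update {suc n} s zero c sv rewrite sv =
  cong suc (#uncolored-cong (λ i → update-other s zero c {suc i} λ ()))
#uncolored-update {suc n} s (suc v) c sv = begin
  suc (isUncolored (update s (suc v) c zero) + #uncolored (update s (suc v) c ∘ suc))
    ≡⟨ cong₂ (λ x y → suc (isUncolored x + y)) (update-other s (suc v) c λ ())
             (#uncolored-cong (update-suc s v c)) ⟩
  suc (isUncolored (s zero) + #uncolored (update (s ∘ suc) v c))
    ≡⟨ sym (+-suc (isUncolored (s zero)) _) ⟩
  isUncolored (s zero) + suc (#uncolored (update (s ∘ suc) v c))
    ≡⟨ cong (isUncolored (s zero) +_) (#uncolored-update (s ∘ suc) v c sv) ⟩
  isUncolored (s zero) + #uncolored (s ∘ suc)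
    ∎
  where open ≡-Reasoning

#uncolored-update-< : ∀ {n} (s : Coloring n) v c → s v ≡ nothing →
                      #uncolored (update s v c) < #uncolored s
#uncolored-update-< s v c sv = ≤-reflexive (#uncolored-update s v c sv)

module Positions {n : ℕ} (G : Graph n) where

  adj⇒≢ : ∀ {v w} → adj G v w ≡ true → w ≢ v
  adj⇒≢ {v} v~w refl with trans (sym v~w) (irrefl G v)
  ... | ()

  adj-sym : ∀ {v w} → adj G v w ≡ true → adj G w v ≡ true
  adj-sym {v} {w} v~w = trans (Graph.sym G w v) v~w

  inN? : ∀ v w → Dec (InN G v w)
  inN? v w = (w ≟ v) ⊎-dec (adj G v w Bool.≟ true)

  dominating? : ∀ s c → Dec (Dominating G s c)
  dominating? s c = all? λ u → any? λ w → inN? u w ×-dec (s w ≟ᵐ just c)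

  domWon? : ∀ s → Dec (DomWon G s)
  domWon? s = dominating? s purple ×-dec dominating? s blue

  settle : ∀ {pass p f s} → ¬ SepyWon G s → (¬ Terminal G s → DomWins G pass p f s) →
           DomWins G pass p f s
  settle {s = s} ¬sepyWon continue with domWon? s
  ... | yes domWon = won domWon ¬sepyWon
  ... | no ¬domWon = continue [ ¬sepyWon , ¬domWon ]

  Monochromatic : Coloring n → Fin n → Color → Set
  Monochromatic s x c = ∀ w → InN G x w → s w ≡ just c

  Nonmonochromatic : Coloring n → Fin n → Set
  Nonmonochromatic s x = ∀ c → ¬ Monochromatic s x c

  SeesOpposite : Coloring n → Fin n → Color → Set
  SeesOpposite s v c = ∃[ w ] (InN G v w × s w ≡ just (opposite c))

  Balanced : Coloring n → Fin n → Set
  Balanced s v = ∀ {c} → s v ≡ just c → SeesOpposite s v c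

  BalancedOn : ∀ {ℓ} → Pred (Fin n) ℓ → Coloring n → Set ℓ
  BalancedOn P s = ∀ {x} → P x → Balanced s x

  balanced⇒nonmonochromatic : ∀ {s x} → Balanced s x → Nonmonochromatic s x
  balanced⇒nonmonochromatic {s} {x} bal c mono with bal (mono x (inj₁ refl))
  ... | w , x~w , sw = opposite-≢ c (just-injective (trans (sym sw) (mono w x~w)))

  seesOpposite-update : ∀ {s v c x d} → s v ≡ nothing → SeesOpposite s x d →
                        SeesOpposite (update s v c) x d
  seesOpposite-update {s} {c = c} sv (w , x~w , sw) = w , x~w , update-colored s c sv sw

  balanced-update : ∀ {s v c x} → s v ≡ nothing → x ≢ v → Balanced s x → Balanced (update s v c) x
  balanced-update {s} {v} {c} sv x≢v bal e =
    seesOpposite-update sv (bal (trans (sym (update-other s v c x≢v)) e))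

  balanced-self : ∀ {s v c} → SeesOpposite (update s v c) v c → Balanced (update s v c) v
  balanced-self {s} {v} {c} opp e with trans (sym (update-same s v c)) e
  ... | refl = opp

  balancedOn-update : ∀ {ℓ} {P : Pred (Fin n) ℓ} {s v c} → s v ≡ nothing →
                      (P v → Balanced (update s v c) v) → BalancedOn P s →
                      BalancedOn P (update s v c)
  balancedOn-update {P = P} {s} {v} {c} sv balancedAtV bal {x} px = by-cases (x ≟ v)
    where
    by-cases : Dec (x ≡ v) → Balanced (update s v c) x
    by-cases (yes refl) = balancedAtV px
    by-cases (no x≢v) = balanced-update sv x≢v (bal px)

  balancedOn⇒¬sepyWon : ∀ {ℓ} {P : Pred (Fin n) ℓ} {s} → Decidable P → BalancedOn P s →
                        (∀ {x} → ¬ P x → Nonmonochromatic s x) → ¬ SepyWon G s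
  balancedOn⇒¬sepyWon P? bal frame (x , c , mono) with P? x
  ... | yes px = balanced⇒nonmonochromatic (bal px) c mono
  ... | no ¬px = frame ¬px c mono

  balancedOnU⇒¬sepyWon : ∀ {s} → BalancedOn U s → ¬ SepyWon G s
  balancedOnU⇒¬sepyWon bal (x , c , mono) = balanced⇒nonmonochromatic (bal tt) c mono

module Balancing {n : ℕ} (G : Graph n) (isolateFree : IsolateFree G) where
  open Positions G

  -- Some u ∈ N[v] has no c in N[u]; but a neighbor of v was already colored c, so N[u]
  -- contains a c-colored vertex other than v (that neighbor if u = v, else u itself).
  legal⇒nonmonochromatic : ∀ {s v c} → Legal G s v c → Nonmonochromatic (update s v c) v
  legal⇒nonmonochromatic {s} {v} {c} (_ , u , v~u , cFreeAtU) d mono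
    with trans (sym (update-same s v c)) (mono v (inj₁ refl)) | isolateFree v
  ... | refl | a , v~a = impossible v~u
    where
    coloredBefore : ∀ {w} → adj G v w ≡ true → s w ≡ just c
    coloredBefore v~w = trans (sym (update-other s v c (adj⇒≢ v~w))) (mono _ (inj₂ v~w))
    impossible : InN G v u → ⊥
    impossible (inj₁ refl) = cFreeAtU a (inj₂ v~a) (coloredBefore v~a)
    impossible (inj₂ v~u′) = cFreeAtU u (inj₁ refl) (coloredBefore v~u′)

  legal⇒¬sepyWon : ∀ {ℓ} {P : Pred (Fin n) ℓ} {s v c} → Decidable P → BalancedOn P s →
                   Legal G s v c → (∀ {x} → ¬ P x → Nonmonochromatic (update s v c) x) →
                   ¬ SepyWon G (update s v c)
  legal⇒¬sepyWon {v = v} P? bal lg frame (x , d , mono) with x ≟ v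
  ... | yes refl = legal⇒nonmonochromatic lg d mono
  ... | no x≢v with P? x
  ...   | yes px = balanced⇒nonmonochromatic (balanced-update (proj₁ lg) x≢v (bal px)) d mono
  ...   | no ¬px = frame ¬px d mono

  Response : Coloring n → Fin n → Color → Set
  Response s v c = SeesOpposite (update s v c) v c ⊎
                   ∃[ y ] (adj G v y ≡ true × update s v c y ≡ nothing ×
                           Legal G (update s v c) y (opposite c))

  response : ∀ {s v c} → Legal G s v c → Response s v c
  response {s} {v} {c} lg with any? (λ w → inN? v w ×-dec (update s v c w ≟ᵐ just (opposite c)))
  ... | yes opp = inj₁ opp
  ... | no ¬opp with any? (λ y → (adj G v y Bool.≟ true) ×-dec (update s v c y ≟ᵐ nothing))
  ...   | yes (y , v~y , free) =
          inj₂ (y , v~y , free , free , v , inj₂ (adj-sym v~y) , λ w v~w e → ¬opp (w , v~w , e))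
  ...   | no ¬free = ⊥-elim (legal⇒nonmonochromatic lg c mono)
    where
    mono : Monochromatic (update s v c) v c
    mono w (inj₁ refl) = update-same s v c
    mono w (inj₂ v~w) =
      remaining-color c (λ e → ¬free (w , v~w , e)) (λ e → ¬opp (w , inj₂ v~w , e))

  balancedOn-answer : ∀ {ℓ} {P : Pred (Fin n) ℓ} {s v c y} → s v ≡ nothing → adj G v y ≡ true →
                      update s v c y ≡ nothing → BalancedOn P s →
                      BalancedOn P (update (update s v c) y (opposite c))
  balancedOn-answer {s = s} {v} {c} {y} sv v~y sy bal {x} px e
    with update-cases (update s v c) y (opposite c) x e
  ... | inj₁ (refl , refl) =
        v , inj₂ (adj-sym v~y) ,
        trans (update-other (update s v c) y (opposite c) (adj⇒≢ v~y ∘ sym))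
              (trans (update-same s v c) (cong just (sym (opposite-involutive c))))
  ... | inj₂ (_ , s₁x) with update-cases s v c x s₁x
  ...   | inj₁ (refl , refl) = y , inj₂ v~y , update-same (update s v c) y (opposite c)
  ...   | inj₂ (_ , sx) = seesOpposite-update sy (seesOpposite-update sv (bal px sx))

  AdjacencyClosed : ∀ {ℓ} → Pred (Fin n) ℓ → Set ℓ
  AdjacencyClosed P = ∀ {x y} → P x → adj G x y ≡ true → P y

  reply : ∀ {ℓ} {P : Pred (Fin n) ℓ} {s v c} → Decidable P → AdjacencyClosed P → P v →
          BalancedOn P s → Legal G s v c →
          (∀ {x} → ¬ P x → Nonmonochromatic (update s v c) x) →
          (∀ {s′} → #uncolored s′ < #uncolored s → BalancedOn P s′ →
            (∀ {x} → ¬ P x → s′ x ≡ s x) → DomWins G true sepy false s′) →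
          DomWins G true dom false (update s v c)
  reply {P = P} {s} {v} {c} P? closed pv bal lg frame continue =
    settle (legal⇒¬sepyWon P? bal lg frame) (answer (response lg))
    where
    sv : s v ≡ nothing
    sv = proj₁ lg
    fixedOffP : ∀ {x} → ¬ P x → update s v c x ≡ s x
    fixedOffP ¬px = update-other s v c λ { refl → ¬px pv }
    answer : Response s v c → ¬ Terminal G (update s v c) → DomWins G true dom false (update s v c)
    answer (inj₁ opp) ¬end =
      dpass ¬end refl
        (continue (#uncolored-update-< s v c sv)
                  (balancedOn-update sv (λ _ → balanced-self opp) bal)
                  fixedOffP)
    answer (inj₂ (y , v~y , sy , lgy)) ¬end =
      dmove y (opposite c) ¬end lgy
        (continue (<-trans (#uncolored-update-< _ y _ sy) (#uncolored-update-< s v c sv))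
                  (balancedOn-answer sv v~y sy bal)
                  (λ ¬px → trans (update-other (update s v c) y (opposite c)
                                                λ { refl → ¬px (closed pv v~y) })
                                  (fixedOffP ¬px)))

  balancingStrategy : ∀ {f} s → Acc _<_ (#uncolored s) → BalancedOn U s → DomWins G true sepy f s
  balancingStrategy s (acc smaller) bal =
    settle (balancedOnU⇒¬sepyWon bal) λ ¬end →
      smove ¬end λ v c lg →
        reply U? (λ _ _ → tt) tt bal lg nowhere
              λ lt bal′ _ → balancingStrategy _ (smaller lt) bal′
    where
    nowhere : ∀ {s x} → ¬ U x → Nonmonochromatic s x
    nowhere ¬u = ⊥-elim (¬u tt)

module Mirror {n : ℕ} (G : Graph n) (isolateFree : IsolateFree G)
              {m : ℕ} (H : Graph m) (f : Fin m → Fin n) (component : IsComponent G H f) where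
  open IsComponent component
  open Positions G
  open Balancing G isolateFree

  Outside : Fin n → Set
  Outside v = ¬ (∃[ i ] f i ≡ v)

  outside? : Decidable Outside
  outside? v = ¬? (any? λ i → f i ≟ v)

  inside : ∀ {v} → ¬ Outside v → ∃[ i ] f i ≡ v
  inside = decidable-stable (any? λ i → f i ≟ _)

  outside-closed : AdjacencyClosed Outside
  outside-closed out v~y (i , refl) with closed i _ (adj-sym v~y)
  ... | j , fj≡v = out (j , fj≡v)

  inN-embed : ∀ {i j} → InN H i j → InN G (f i) (f j)
  inN-embed (inj₁ refl) = inj₁ refl
  inN-embed {i} {j} (inj₂ i~j) = inj₂ (trans (sym (induced i j)) i~j)

  inN-restrict : ∀ {i w} → InN G (f i) w → ∃[ j ] (f j ≡ w × InN H i j)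
  inN-restrict {i} (inj₁ refl) = i , refl , inj₁ refl
  inN-restrict {i} {w} (inj₂ fi~w) with closed i w fi~w
  ... | j , refl = j , refl , inj₂ (trans (induced i j) fi~w)

  legal-restrict : ∀ {s t i c} → s ∘ f ≗ t → Legal G s (f i) c → Legal H t i c
  legal-restrict {s} {t} {i} {c} s∘f≗t (si , u , fi~u , cFreeAtU) with inN-restrict fi~u
  ... | j , refl , i~j = trans (sym (s∘f≗t i)) si , j , i~j ,
                         λ k j~k e → cFreeAtU (f k) (inN-embed j~k) (trans (s∘f≗t k) e)

  legal-embed : ∀ {s t i c} → s ∘ f ≗ t → Legal H t i c → Legal G s (f i) c
  legal-embed {s} {t} {i} {c} s∘f≗t (ti , j , i~j , cFreeAtJ) =
    trans (s∘f≗t i) ti , f j , inN-embed i~j , cFreeAtFj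
    where
    cFreeAtFj : ∀ w → InN G (f j) w → s w ≢ just c
    cFreeAtFj w fj~w e with inN-restrict fj~w
    ... | k , refl , j~k = cFreeAtJ k j~k (trans (sym (s∘f≗t k)) e)

  update-embed : ∀ {s t i c} → s ∘ f ≗ t → update s (f i) c ∘ f ≗ update t i c
  update-embed {s} {t} {i} {c} s∘f≗t k = by-cases (k ≟ i)
    where
    by-cases : Dec (k ≡ i) → update s (f i) c (f k) ≡ update t i c k
    by-cases (yes refl) = trans (update-same s (f k) c) (sym (update-same t k c))
    by-cases (no k≢i) = trans (update-other s (f i) c (k≢i ∘ injective))
                              (trans (s∘f≗t k) (sym (update-other t i c k≢i)))

  update-outside : ∀ {s t v c} → Outside v → s ∘ f ≗ t → update s v c ∘ f ≗ t
  update-outside {s} {v = v} {c} out s∘f≗t k =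
    trans (update-other s v c λ fk≡v → out (k , fk≡v)) (s∘f≗t k)

  nonmonochromatic-inside : ∀ {s t} → s ∘ f ≗ t → ¬ SepyWon H t →
                            ∀ {x} → ¬ Outside x → Nonmonochromatic s x
  nonmonochromatic-inside {s} {t} s∘f≗t ¬sepyWon ¬out c mono with inside ¬out
  ... | j , refl = ¬sepyWon (j , c , λ k j~k → trans (sym (s∘f≗t k)) (mono (f k) (inN-embed j~k)))

  dominating : ∀ {t} → DomWon H t → ∀ c → Dominating H t c
  dominating (purples , _) purple = purples
  dominating (_ , blues) blue = blues

  balanced-everywhere : ∀ {s t} → s ∘ f ≗ t → DomWon H t → BalancedOn Outside s → BalancedOn U s
  balanced-everywhere {s} {t} s∘f≗t domWon bal {x} _ {c} sx with outside? x
  ... | yes out = bal out sx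
  ... | no ¬out with inside ¬out
  ...   | i , refl with dominating domWon (opposite c) i
  ...     | j , i~j , tj = f j , inN-embed i~j , trans (s∘f≗t j) tj

  mutual
    mirrorSepy : ∀ {t} → DomWins H false sepy false t → ∀ s → Acc _<_ (#uncolored s) →
                 s ∘ f ≗ t → BalancedOn Outside s → DomWins G true sepy false s
    mirrorSepy (won domWon _) s acs s∘f≗t bal =
      balancingStrategy s acs (balanced-everywhere s∘f≗t domWon bal)
    mirrorSepy (smove ¬endH strategyH) = mirrorSepyTurn ¬endH strategyH

    mirrorSepyTurn : ∀ {t} → ¬ Terminal H t →
                     (∀ i c → Legal H t i c → DomWins H false dom false (update t i c)) →
                     ∀ s → Acc _<_ (#uncolored s) → s ∘ f ≗ t → BalancedOn Outside s →
                     DomWins G true sepy false s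
    mirrorSepyTurn ¬endH strategyH s acs s∘f≗t bal =
      settle (balancedOn⇒¬sepyWon outside? bal (nonmonochromatic-inside s∘f≗t (¬endH ∘ inj₁)))
             λ ¬end → smove ¬end (mirrorSepyMove ¬endH strategyH s acs s∘f≗t bal)

    mirrorSepyMove : ∀ {t} → ¬ Terminal H t →
                     (∀ i c → Legal H t i c → DomWins H false dom false (update t i c)) →
                     ∀ s → Acc _<_ (#uncolored s) → s ∘ f ≗ t → BalancedOn Outside s →
                     ∀ v c → Legal G s v c → DomWins G true dom false (update s v c)
    mirrorSepyMove ¬endH strategyH s (acc smaller) s∘f≗t bal v c lg with any? (λ i → f i ≟ v)
    ... | yes (i , refl) =
          mirrorDom (strategyH i c (legal-restrict s∘f≗t lg)) (update-embed {s} s∘f≗t)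
                    (balancedOn-update (proj₁ lg) (λ out → ⊥-elim (out (i , refl))) bal)
    ... | no out =
          reply outside? outside-closed out bal lg
                (nonmonochromatic-inside (update-outside {s} out s∘f≗t) (¬endH ∘ inj₁))
                λ lt bal′ fixed →
                  mirrorSepyTurn ¬endH strategyH _ (smaller lt)
                                 (λ k → trans (fixed λ out′ → out′ (k , refl)) (s∘f≗t k)) bal′

    mirrorDomMove : ∀ {fl s t} i c → ¬ Terminal H t → Legal H t i c →
                    DomWins H false sepy false (update t i c) →
                    s ∘ f ≗ t → BalancedOn Outside s → DomWins G true dom fl s
    mirrorDomMove {s = s} i c ¬endH lgH next s∘f≗t bal =
      settle (balancedOn⇒¬sepyWon outside? bal (nonmonochromatic-inside s∘f≗t (¬endH ∘ inj₁)))
             λ ¬end → dmove (f i) c ¬end (legal-embed s∘f≗t lgH)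
                        (mirrorSepy next _ (<-wellFounded _) (update-embed {s} s∘f≗t)
                          (balancedOn-update (trans (s∘f≗t i) (proj₁ lgH))
                                             (λ out → ⊥-elim (out (i , refl))) bal))

    mirrorDom : ∀ {s t} → DomWins H false dom false t → s ∘ f ≗ t → BalancedOn Outside s →
                DomWins G true dom false s
    mirrorDom {s} (won domWon _) s∘f≗t bal =
      settle (balancedOnU⇒¬sepyWon balU)
             λ ¬end → dpass ¬end refl (balancingStrategy s (<-wellFounded _) balU)
      where
      balU : BalancedOn U s
      balU = balanced-everywhere s∘f≗t domWon bal
    mirrorDom (dmove i c ¬endH lgH next) = mirrorDomMove i c ¬endH lgH next
    mirrorDom (dpass _ () _)

  mirrorStart : DomWins H false dom true empty → DomWins G true dom true empty
  mirrorStart (won (purples , _) _) with purples (fromℕ< nonempty)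
  ... | _ , _ , ()
  mirrorStart (dmove i c ¬endH lgH next) = mirrorDomMove i c ¬endH lgH next (λ _ → refl) (λ _ ())

mainTheorem4 :
    (∀ {n} (G : Graph n) → IsolateFree G → DomWins G true sepy true empty) ×
    (∀ {n} (G : Graph n) → IsolateFree G → HasDomWinComponent G →
      DomWins G true dom true empty)
mainTheorem4 = sepyStart , domStart
  where
  sepyStart : ∀ {n} (G : Graph n) → IsolateFree G → DomWins G true sepy true empty
  sepyStart G isolateFree =
    Balancing.balancingStrategy G isolateFree empty (<-wellFounded _) λ _ ()
  domStart : ∀ {n} (G : Graph n) → IsolateFree G → HasDomWinComponent G →
             DomWins G true dom true empty
  domStart G isolateFree (_ , H , f , component , domWinsH) =
    Mirror.mirrorStart G isolateFree H f component domWinsH
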